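{- Let $k\ge 0$ be an integer, $0\le\ell\le d$ and $0\le i_1<\dots<i_k<\ell$. Then $$\Diamond(\Gamma_{i_1},\dots,\Gamma_{i_k},\Gamma_\ell)\cong\Diamond(\Gamma_{i_1},\dots,\Gamma_{i_k},\Gamma_{\ell+1},\dots,\Gamma_{d+1}).$$
   Context: $\sigma^{d+1}$ is the simplex on $\{0,\dots,d+1\}$, $\Gamma_i=\{0,\dots,d+1\}\setminus\{i\}$, and $\Diamond(\Gamma_{j_1},\dots,\Gamma_{j_s})$ denotes $\Diamond$ applied to the subcomplex of $\partial\sigma^{d+1}$ generated by $\Gamma_{j_1},\dots,\Gamma_{j_s}$. For a pure $d$-dimensional subcomplex $\Gamma\subseteq\partial\sigma^{d+1}$, $\Diamond(\Gamma)$ is obtained by, for $i=0,1,\dots,d$ in order, stellarly subdividing the current complex $K$ at $F_i=\{i+1,\dots,d+1\}$ whenever $F_i\in K$, i.e. replacing $K$ by $(K\setminus F_i)\cup(\langle v_i\rangle*\partial F_i*\mathrm{lk}_K(F_i))$ with new vertex $v_i$. The isomorphism is one of simplicial complexes. -}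

module Defs where

open import Data.Nat using (ℕ; suc; _+_; _<ᵇ_; _≡ᵇ_)
open import Data.Bool using (Bool; _∧_; not)
open import Data.Fin using (Fin; toℕ; _↑ˡ_; _↑ʳ_)
open import Data.Fin.Subset using (Subset; _⊆_; _⊂_; _∪_; _∩_; ⁅_⁆; ⊥)
open import Data.Fin.Permutation using (Permutation′; _⟨$⟩ˡ_)
open import Data.Vec using (tabulate; lookup)
open import Data.List using (List; foldl; allFin)
open import Data.List.Relation.Unary.Any using (Any)
open import Data.Product using (Σ; _×_; ∃-syntax)
open import Data.Sum using (_⊎_)
open import Relation.Nullary using (¬_)
open import Relation.Binary.PropositionalEquality using (_≡_)

-- Ambient vertex set for dimension d:
--   Fin (d + 2 + (d + 1)); the first d+2 elements are the original vertices
--   0,…,d+1 of σ^{d+1}; element (d+2)+i is the new vertex v_i (0 ≤ i ≤ d).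
N : ℕ → ℕ
N d = d + 2 + (d + 1)

Complex : ℕ → Set₁
Complex d = Subset (N d) → Set

newV : (d : ℕ) → Fin (d + 1) → Fin (N d)
newV d i = (d + 2) ↑ʳ i

Γ : (d : ℕ) → ℕ → Subset (N d)
Γ d j = tabulate (λ x → (toℕ x <ᵇ d + 2) ∧ not (toℕ x ≡ᵇ j))

generated : (d : ℕ) → List ℕ → Complex d
generated d js σ = Any (λ j → σ ⊆ Γ d j) js

Fface : (d : ℕ) → Fin (d + 1) → Subset (N d)
Fface d i = tabulate (λ x → (toℕ i <ᵇ toℕ x) ∧ (toℕ x <ᵇ d + 2))

-- Stellar subdivision of K at F with new vertex v, performed when F ∈ K:
--   (K ∖ F) ∪ (⟨v⟩ * ∂F * lk_K F),
-- where K ∖ F removes all faces containing F; otherwise K is unchanged.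
stellar : (d : ℕ) → Subset (N d) → Fin (N d) → Complex d → Complex d
stellar d F v K σ =
  (K F × ((K σ × ¬ (F ⊆ σ))
          ⊎ (∃[ G ] ∃[ H ] ∃[ L ]
               (G ⊆ ⁅ v ⁆ × H ⊂ F × (L ∩ F ≡ ⊥) × K (L ∪ F)
                × σ ≡ G ∪ (H ∪ L)))))
  ⊎ (¬ K F × K σ)

diamondC : (d : ℕ) → Complex d → Complex d
diamondC d K = foldl (λ K' i → stellar d (Fface d i) (newV d i) K') K (allFin (d + 1))

diamond : (d : ℕ) → List ℕ → Complex d
diamond d js = diamondC d (generated d js)

-- image of a vertex set under a permutation π: j ∈ π[σ] iff π⁻¹ j ∈ σ
image : {n : ℕ} → Permutation′ n → Subset n → Subset n
image π σ = tabulate (λ j → lookup σ (π ⟨$⟩ˡ j))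

-- Isomorphism of simplicial complexes (realised by a permutation of the
-- common ambient vertex set, mapping faces exactly onto faces)
Iso : (d : ℕ) → Complex d → Complex d → Set
Iso d K K' = Σ (Permutation′ (N d)) λ π →
  ∀ σ → (K σ → K' (image π σ)) × (K' (image π σ) → K σ)

module Submission where

-- After subdividing at F₀, …, F_{k-1}, the subdivision of the facet Γ_j has an explicit
-- description: a face avoids the vertex j, contains a new vertex v_m only for j ≤ m < k,
-- never contains both m and v_m, and misses some original vertex ≥ k.  A stellar
-- subdivision at F_k passes from stage k to stage k+1 (the faces through v_k form the cone
-- over ∂F_k * lk F_k), so ◇(Γ_J) is the union over j ∈ J of the pieces at stage d+1.  The
-- transposition of ℓ and v_ℓ maps the piece of each j < ℓ to itself, and the piece of ℓ
-- onto the union of the pieces of ℓ < j ≤ d+1: an image face lies in the piece of the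
-- least j > ℓ whose vertex it misses.

open import Defs
open import Data.Bool using (Bool; true; false; T; not)
open import Data.Bool.Properties using (T-≡; T-not-≡; T-∧)
open import Data.Empty using (⊥-elim)
open import Data.Fin using (Fin; zero; suc; toℕ; fromℕ<; _≟_)
open import Data.Fin.Permutation using (Permutation′; _⟨$⟩ˡ_; _⟨$⟩ʳ_; inverseˡ; transpose)
import Data.Fin.Permutation.Components as PC
open import Data.Fin.Properties
  using (toℕ-injective; toℕ-↑ʳ; toℕ<n; toℕ-fromℕ<; toℕ-inject; ¬∀⟶∃¬; ¬∀⟶∃¬-smallest)
open import Data.Fin.Subset using (Subset; _∈_; _∉_; _⊆_; _⊂_; _∪_; _∩_; ∁; ⁅_⁆; ⊥)
open import Data.Fin.Subset.Properties
  using (_∈?_; x∈p∪q⁺; x∈p∪q⁻; x∈p∩q⁺; x∈p∩q⁻; p⊆p∪q; q⊆p∪q; p∩q⊆q; ⊆-antisym; ∉⊥; ⊥⊆;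
         x∈⁅x⁆; x∈⁅y⁆⇒x≡y; x∈∁p⇒x∉p; x∉p⇒x∈∁p)
open import Data.List using (List; []; _∷_; _++_; map; upTo; foldl; tabulate)
open import Data.List.Relation.Unary.All using (All; []; _∷_)
import Data.List.Relation.Unary.All as All
import Data.List.Relation.Unary.All.Properties as All
open import Data.List.Relation.Unary.Any using (Any; here; there; any?; satisfied)
import Data.List.Relation.Unary.Any as Any
import Data.List.Relation.Unary.Any.Properties as Any
open import Data.List.Relation.Unary.Linked using (Linked)
open import Data.Nat using (ℕ; zero; suc; _+_; _∸_; _≤_; _<_; _≡ᵇ_; z≤n; s≤s)
open import Data.Nat.Properties hiding (_≟_)
open import Data.Product using (∃; _×_; _,_; proj₁; proj₂)
open import Data.Sum using (_⊎_; inj₁; inj₂; [_,_]′)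
open import Data.Vec using () renaming (tabulate to tabulateᵛ)
open import Data.Vec.Properties using (lookup∘tabulate; []=⇒lookup; lookup⇒[]=)
open import Function using (_∘_)
open import Function.Bundles using (Equivalence)
open import Relation.Nullary using (¬_; Dec; yes; no)
open import Relation.Nullary.Decidable using (_⊎-dec_; dec-true; dec-false)
open import Relation.Binary.PropositionalEquality using (_≡_; _≢_; refl; sym; trans; cong; subst)
open import Relation.Unary using (_≐_)

private variable
  n : ℕ
  A : Set
  P Q R : A → Set
  xs : List A

Any-mapWithAll : All P xs → (∀ {x} → P x → Q x → R x) → Any Q xs → Any R xs
Any-mapWithAll (p ∷ _)  f (here q)  = here (f p q)
Any-mapWithAll (_ ∷ ps) f (there q) = there (Any-mapWithAll ps f q)

module _ {ℓ n : ℕ} where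

  Any-upFrom⁺ : ∀ {j} → ℓ < j → j ≤ ℓ + n → P j → Any P (map (λ t → suc ℓ + t) (upTo n))
  Any-upFrom⁺ {P = P} {j} ℓ<j j≤ℓ+n Pj = Any.map⁺ (Any.applyUpTo⁺ _ (subst P (sym (m+[n∸m]≡n ℓ<j)) Pj) i<n)
    where
      i<n : j ∸ suc ℓ < n
      i<n = +-cancelˡ-≤ ℓ _ _ (subst (_≤ ℓ + n) (trans (sym (m+[n∸m]≡n ℓ<j)) (sym (+-suc ℓ _))) j≤ℓ+n)

  Any-upFrom⁻ : Any P (map (λ t → suc ℓ + t) (upTo n)) → ∃ λ j → ℓ < j × j ≤ ℓ + n × P j
  Any-upFrom⁻ any with Any.applyUpTo⁻ _ (Any.map⁻ any)
  ... | i , i<n , Pj = suc ℓ + i , s≤s (m≤m+n ℓ i) , subst (_≤ ℓ + n) (+-suc ℓ i) (+-monoʳ-≤ ℓ i<n) , Pj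

  All-upFrom⁺ : (∀ {j} → ℓ < j → j ≤ ℓ + n → P j) → All P (map (λ t → suc ℓ + t) (upTo n))
  All-upFrom⁺ h = All.map⁺ (All.applyUpTo⁺₁ _ n λ i<n →
    h (s≤s (m≤m+n ℓ _)) (subst (_≤ ℓ + n) (+-suc ℓ _) (+-monoʳ-≤ ℓ i<n)))

∈-tabulate⁺ : {f : Fin n → Bool} {x : Fin n} → T (f x) → x ∈ tabulateᵛ f
∈-tabulate⁺ {f = f} {x} t = lookup⇒[]= x (tabulateᵛ f) (trans (lookup∘tabulate f x) (Equivalence.to T-≡ t))

∈-tabulate⁻ : {f : Fin n → Bool} {x : Fin n} → x ∈ tabulateᵛ f → T (f x)
∈-tabulate⁻ {f = f} {x} p = Equivalence.from T-≡ (trans (sym (lookup∘tabulate f x)) ([]=⇒lookup p))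

≢⇒T-not-≡ᵇ : ∀ {a b} → a ≢ b → T (not (a ≡ᵇ b))
≢⇒T-not-≡ᵇ {a} {b} a≢b with a ≡ᵇ b in eq
... | false = _
... | true  = a≢b (≡ᵇ⇒≡ a b (subst T (sym eq) _))

T-not-≡ᵇ⇒≢ : ∀ {a b} → T (not (a ≡ᵇ b)) → a ≢ b
T-not-≡ᵇ⇒≢ {a} t refl with () ← trans (sym (Equivalence.to T-not-≡ t)) (Equivalence.to T-≡ (≡⇒≡ᵇ a a refl))

∈-image⁺ : (π : Permutation′ n) {σ : Subset n} {x : Fin n} → π ⟨$⟩ˡ x ∈ σ → x ∈ image π σ
∈-image⁺ π {x = x} p = lookup⇒[]= x _ (trans (lookup∘tabulate _ x) ([]=⇒lookup p))

∈-image⁻ : (π : Permutation′ n) {σ : Subset n} {x : Fin n} → x ∈ image π σ → π ⟨$⟩ˡ x ∈ σ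
∈-image⁻ π {σ} {x} p = lookup⇒[]= _ σ (trans (sym (lookup∘tabulate _ x)) ([]=⇒lookup p))

data TransposeView (s : Fin n → Fin n) (a b x : Fin n) : Set where
  at-a  : x ≡ a → s x ≡ b → TransposeView s a b x
  at-b  : x ≡ b → s x ≡ a → TransposeView s a b x
  other : x ≢ a → x ≢ b → s x ≡ x → TransposeView s a b x

transpose-view : (a b x : Fin n) → TransposeView (PC.transpose a b) a b x
transpose-view a b x with x ≟ a | x ≟ b
... | yes x≡a | _        = at-a x≡a (subst (λ y → PC.transpose a b y ≡ b) (sym x≡a) transpose-a)
  where
    transpose-a : PC.transpose a b a ≡ b
    transpose-a rewrite dec-true (a ≟ a) refl = refl
... | no x≢a  | yes x≡b = at-b x≡b (subst (λ y → PC.transpose a b y ≡ a) (sym x≡b) transpose-b)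
  where
    transpose-b : PC.transpose a b b ≡ a
    transpose-b rewrite dec-false (b ≟ a) (x≢a ∘ trans x≡b) | dec-true (b ≟ b) refl = refl
... | no x≢a  | no x≢b  = other x≢a x≢b transpose-x
  where
    transpose-x : PC.transpose a b x ≡ x
    transpose-x rewrite dec-false (x ≟ a) x≢a | dec-false (x ≟ b) x≢b = refl

TransposeView-sym : {s : Fin n → Fin n} {a b x : Fin n} → TransposeView s a b x → TransposeView s b a x
TransposeView-sym (at-a x≡a sx≡b)      = at-b x≡a sx≡b
TransposeView-sym (at-b x≡b sx≡a)      = at-a x≡b sx≡a
TransposeView-sym (other x≢a x≢b sx≡x) = other x≢b x≢a sx≡x

_∖_ : Subset n → Subset n → Subset n
σ ∖ p = σ ∩ ∁ p

∈∖⁺ : {σ p : Subset n} {x : Fin n} → x ∈ σ → x ∉ p → x ∈ σ ∖ p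
∈∖⁺ x∈σ x∉p = x∈p∩q⁺ (x∈σ , x∉p⇒x∈∁p x∉p)

∈∖⁻ : {σ p : Subset n} {x : Fin n} → x ∈ σ ∖ p → x ∈ σ × x ∉ p
∈∖⁻ {σ = σ} {p} q = let x∈σ , x∈∁p = x∈p∩q⁻ σ (∁ p) q in x∈σ , x∈∁p⇒x∉p x∈∁p

∖∪-disjoint : (σ p q : Subset n) → (σ ∖ (p ∪ q)) ∩ p ≡ ⊥
∖∪-disjoint σ p q = ⊆-antisym empty ⊥⊆
  where
    empty : (σ ∖ (p ∪ q)) ∩ p ⊆ ⊥
    empty r = let x∈σ∖ , x∈p = x∈p∩q⁻ _ p r in ⊥-elim (proj₂ (∈∖⁻ x∈σ∖) (x∈p∪q⁺ (inj₁ x∈p)))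

split-at : {σ : Subset n} {x : Fin n} (p : Subset n) → x ∈ σ → σ ≡ ⁅ x ⁆ ∪ ((σ ∩ p) ∪ (σ ∖ (p ∪ ⁅ x ⁆)))
split-at {σ = σ} {x} p x∈σ = ⊆-antisym into onto
  where
    into : σ ⊆ ⁅ x ⁆ ∪ ((σ ∩ p) ∪ (σ ∖ (p ∪ ⁅ x ⁆)))
    into {y} y∈σ with y ≟ x | y ∈? p
    ... | yes refl | _       = x∈p∪q⁺ (inj₁ (x∈⁅x⁆ x))
    ... | no _     | yes y∈p = x∈p∪q⁺ (inj₂ (x∈p∪q⁺ (inj₁ (x∈p∩q⁺ (y∈σ , y∈p)))))
    ... | no y≢x   | no y∉p  = x∈p∪q⁺ (inj₂ (x∈p∪q⁺ (inj₂ (∈∖⁺ y∈σ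
                                  ([ y∉p , y≢x ∘ x∈⁅y⁆⇒x≡y x ]′ ∘ x∈p∪q⁻ p ⁅ x ⁆)))))
    onto : ⁅ x ⁆ ∪ ((σ ∩ p) ∪ (σ ∖ (p ∪ ⁅ x ⁆))) ⊆ σ
    onto q with x∈p∪q⁻ ⁅ x ⁆ _ q
    ... | inj₁ y∈⁅x⁆ = subst (_∈ σ) (sym (x∈⁅y⁆⇒x≡y x y∈⁅x⁆)) x∈σ
    ... | inj₂ r with x∈p∪q⁻ (σ ∩ p) _ r
    ...   | inj₁ y∈σ∩p = proj₁ (x∈p∩q⁻ σ p y∈σ∩p)
    ...   | inj₂ y∈σ∖  = proj₁ (∈∖⁻ y∈σ∖)

module Stages (d : ℕ) where

  D : ℕ
  D = d + 2

  V : Set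
  V = Fin (N d)

  private variable
    j m : ℕ
    x y : V
    σ τ : Subset (N d)

  d+1<D : d + 1 < D
  d+1<D = +-monoʳ-< d (n<1+n 1)

  ≤1+d⇒<D : j ≤ suc d → j < D
  ≤1+d⇒<D {j} j≤1+d = subst (j <_) (+-comm 2 d) (s≤s j≤1+d)

  <D⇒≤1+d : j < D → j ≤ suc d
  <D⇒≤1+d {j} j<D = m<1+n⇒m≤n (subst (j <_) (+-comm d 2) j<D)

  orig : ∀ m → m < D → V
  orig m m<D = fromℕ< (m≤n⇒m≤n+o (d + 1) m<D)

  toℕ-orig : (m<D : m < D) → toℕ (orig m m<D) ≡ m
  toℕ-orig m<D = toℕ-fromℕ< _

  paired⇒new : toℕ y ≡ D + m → D ≤ toℕ y
  paired⇒new {m = m} e = subst (D ≤_) (sym e) (m≤m+n D m)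

  NoPair : Subset (N d) → Set
  NoPair σ = ∀ {x y} → x ∈ σ → y ∈ σ → toℕ y ≢ D + toℕ x

  Gap : ℕ → Subset (N d) → Set
  Gap k σ = ∃ λ x → k ≤ toℕ x × toℕ x < D × x ∉ σ

  -- σ is a face of the subdivision of Γ_j at F₀, …, F_{k-1}.
  record Face (k j : ℕ) (σ : Subset (N d)) : Set where
    field
      avoids    : ∀ {x} → x ∈ σ → toℕ x ≢ j
      new-above : ∀ {x} → x ∈ σ → D ≤ toℕ x → D + j ≤ toℕ x
      new-below : ∀ {x} → x ∈ σ → toℕ x < D + k
      no-pair   : NoPair σ
      gap       : Gap k σ

  Faces : List ℕ → ℕ → Complex d
  Faces J k σ = Any (λ j → Face k j σ) J

  Faces⇒Gap : ∀ {J k} → Faces J k σ → Gap k σ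
  Faces⇒Gap = Face.gap ∘ proj₂ ∘ satisfied

  Face-mono : ∀ {k} → τ ⊆ σ → Face k j σ → Face k j τ
  Face-mono τ⊆σ f = record
    { avoids    = avoids ∘ τ⊆σ
    ; new-above = new-above ∘ τ⊆σ
    ; new-below = new-below ∘ τ⊆σ
    ; no-pair   = λ p q → no-pair (τ⊆σ p) (τ⊆σ q)
    ; gap       = let x , k≤x , x<D , x∉σ = gap in x , k≤x , x<D , x∉σ ∘ τ⊆σ
    }
    where open Face f

  ∈Γ⁺ : toℕ x < D → toℕ x ≢ j → x ∈ Γ d j
  ∈Γ⁺ x<D x≢j = ∈-tabulate⁺ (Equivalence.from T-∧ (<⇒<ᵇ x<D , ≢⇒T-not-≡ᵇ x≢j))

  ∈Γ⁻ : x ∈ Γ d j → toℕ x < D × toℕ x ≢ j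
  ∈Γ⁻ p = let x<D , x≢j = Equivalence.to T-∧ (∈-tabulate⁻ p) in <ᵇ⇒< _ _ x<D , T-not-≡ᵇ⇒≢ x≢j

  ⊆Γ⇒Face₀ : j < D → σ ⊆ Γ d j → Face 0 j σ
  ⊆Γ⇒Face₀ {j} {σ} j<D σ⊆Γ = record
    { avoids    = proj₂ ∘ ∈Γ⁻ ∘ σ⊆Γ
    ; new-above = λ p D≤x → ⊥-elim (<⇒≱ (old p) D≤x)
    ; new-below = λ {x} p → subst (toℕ x <_) (sym (+-identityʳ D)) (old p)
    ; no-pair   = λ p q e → <⇒≱ (old q) (paired⇒new e)
    ; gap       = orig j j<D , z≤n , subst (_< D) (sym (toℕ-orig j<D)) j<D
                , λ p → proj₂ (∈Γ⁻ (σ⊆Γ p)) (toℕ-orig j<D)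
    }
    where
      old : x ∈ σ → toℕ x < D
      old = proj₁ ∘ ∈Γ⁻ ∘ σ⊆Γ

  Face₀⇒⊆Γ : Face 0 j σ → σ ⊆ Γ d j
  Face₀⇒⊆Γ f {x} p = ∈Γ⁺ (subst (toℕ x <_) (+-identityʳ D) (new-below p)) (avoids p)
    where open Face f

  generated≐Faces₀ : {J : List ℕ} → All (_< D) J → generated d J ≐ Faces J 0
  generated≐Faces₀ J<D = Any-mapWithAll J<D ⊆Γ⇒Face₀ , Any.map Face₀⇒⊆Γ

  module Stage (i : Fin (d + 1)) where

    k : ℕ
    k = toℕ i

    F : Subset (N d)
    F = Fface d i

    v : V
    v = newV d i

    toℕ-v : toℕ v ≡ D + k
    toℕ-v = toℕ-↑ʳ D i

    k<D : k < D
    k<D = <-trans (toℕ<n i) d+1<D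

    k<D+k : k < D + k
    k<D+k = <-≤-trans k<D (m≤m+n D k)

    D+k<D+1+k : D + k < D + suc k
    D+k<D+1+k = +-monoʳ-< D (n<1+n k)

    o : V
    o = orig k k<D

    toℕ-o : toℕ o ≡ k
    toℕ-o = toℕ-orig k<D

    ∈F⁺ : k < toℕ x → toℕ x < D → x ∈ F
    ∈F⁺ k<x x<D = ∈-tabulate⁺ (Equivalence.from T-∧ (<⇒<ᵇ k<x , <⇒<ᵇ x<D))

    ∈F⁻ : x ∈ F → k < toℕ x × toℕ x < D
    ∈F⁻ p = let k<x , x<D = Equivalence.to T-∧ (∈-tabulate⁻ p) in <ᵇ⇒< _ _ k<x , <ᵇ⇒< _ _ x<D

    o∉F : o ∉ F
    o∉F p = <-irrefl (sym toℕ-o) (proj₁ (∈F⁻ p))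

    Gap-o : o ∉ σ → Gap k σ
    Gap-o o∉σ = o , ≤-reflexive (sym toℕ-o) , subst (_< D) (sym toℕ-o) k<D , o∉σ

    ⊈F⇒Gap : ¬ F ⊆ σ → Gap (suc k) σ
    ⊈F⇒Gap {σ} F⊈σ with ¬∀⟶∃¬ (N d) (λ x → x ∈ F → x ∈ σ) decide (λ all → F⊈σ (all _))
      where
        decide : ∀ x → Dec (x ∈ F → x ∈ σ)
        decide x with x ∈? σ | x ∈? F
        ... | yes x∈σ | _       = yes (λ _ → x∈σ)
        ... | no x∉σ  | yes x∈F = no (λ h → x∉σ (h x∈F))
        ... | no _    | no x∉F  = yes (⊥-elim ∘ x∉F)
    ... | x , ¬[x∈F→x∈σ] with x ∈? F
    ...   | yes x∈F = x , proj₁ (∈F⁻ x∈F) , proj₂ (∈F⁻ x∈F) , λ x∈σ → ¬[x∈F→x∈σ] (λ _ → x∈σ)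
    ...   | no x∉F  = ⊥-elim (¬[x∈F→x∈σ] (⊥-elim ∘ x∉F))

    Gap⇒∩F⊂F : Gap (suc k) σ → σ ∩ F ⊂ F
    Gap⇒∩F⊂F {σ} (z , k<z , z<D , z∉σ) = p∩q⊆q σ F , z , ∈F⁺ k<z z<D , z∉σ ∘ proj₁ ∘ x∈p∩q⁻ σ F

    Gap⇒⊈F : Gap (suc k) σ → ¬ F ⊆ σ
    Gap⇒⊈F (z , k<z , z<D , z∉σ) F⊆σ = z∉σ (F⊆σ (∈F⁺ k<z z<D))

    Face-F : j ≤ k → Face k j F
    Face-F j≤k = record
      { avoids    = λ p e → <⇒≢ (≤-<-trans j≤k (proj₁ (∈F⁻ p))) (sym e)
      ; new-above = λ p D≤x → ⊥-elim (<⇒≱ (proj₂ (∈F⁻ p)) D≤x)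
      ; new-below = λ p → <-≤-trans (proj₂ (∈F⁻ p)) (m≤m+n D k)
      ; no-pair   = λ p q e → <⇒≱ (proj₂ (∈F⁻ q)) (paired⇒new e)
      ; gap       = Gap-o o∉F
      }

    Face-⊇F⇒o∉ : F ⊆ τ → Face k j τ → o ∉ τ
    Face-⊇F⇒o∉ {τ} F⊆τ f with Face.gap f
    ... | z , k≤z , z<D , z∉τ with m≤n⇒m<n∨m≡n k≤z
    ...   | inj₁ k<z = ⊥-elim (z∉τ (F⊆τ (∈F⁺ k<z z<D)))
    ...   | inj₂ k≡z = subst (_∉ τ) (toℕ-injective (trans (sym k≡z) (sym toℕ-o))) z∉τ

    Face-⊇F⇒≤ : j < D → F ⊆ τ → Face k j τ → j ≤ k
    Face-⊇F⇒≤ {j} j<D F⊆τ f with j ≤? k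
    ... | yes j≤k = j≤k
    ... | no j≰k  = ⊥-elim (Face.avoids f (F⊆τ (∈F⁺ (subst (k <_) (sym toℕ-oj) (≰⇒> j≰k))
                                                   (subst (_< D) (sym toℕ-oj) j<D))) toℕ-oj)
      where
        toℕ-oj : toℕ (orig j j<D) ≡ j
        toℕ-oj = toℕ-orig j<D

    Face-suc : ¬ F ⊆ σ → Face k j σ → Face (suc k) j σ
    Face-suc F⊈σ f = record
      { avoids    = avoids
      ; new-above = new-above
      ; new-below = λ p → <-trans (new-below p) D+k<D+1+k
      ; no-pair   = no-pair
      ; gap       = ⊈F⇒Gap F⊈σ
      }
      where open Face f

    <D+1+k∧≢v⇒<D+k : toℕ x < D + suc k → x ≢ v → toℕ x < D + k
    <D+1+k∧≢v⇒<D+k {x} x< x≢v =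
      ≤∧≢⇒< (m<1+n⇒m≤n (subst (toℕ x <_) (+-suc D k) x<)) (λ e → x≢v (toℕ-injective (trans e (sym toℕ-v))))

    Face-pred : v ∉ σ → Face (suc k) j σ → Face k j σ
    Face-pred {σ} v∉σ f = record
      { avoids    = avoids
      ; new-above = new-above
      ; new-below = λ p → <D+1+k∧≢v⇒<D+k (new-below p) (λ { refl → v∉σ p })
      ; no-pair   = no-pair
      ; gap       = let z , k<z , z<D , z∉σ = gap in z , <⇒≤ k<z , z<D , z∉σ
      }
      where open Face f

    Face-∋v⇒≤ : v ∈ σ → Face (suc k) j σ → j ≤ k
    Face-∋v⇒≤ {j = j} v∈σ f =
      +-cancelˡ-≤ D j k (subst (D + j ≤_) toℕ-v (Face.new-above f v∈σ (paired⇒new toℕ-v)))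

    ∈cone⁻ : ∀ {G H L} → G ⊆ ⁅ v ⁆ → x ∈ G ∪ (H ∪ L) → x ≡ v ⊎ x ∈ H ⊎ x ∈ L
    ∈cone⁻ {G = G} {H} {L} G⊆v p with x∈p∪q⁻ G _ p
    ... | inj₁ x∈G = inj₁ (x∈⁅y⁆⇒x≡y v (G⊆v x∈G))
    ... | inj₂ q   = inj₂ (x∈p∪q⁻ H L q)

    Face-cone : ∀ {G H L} → j < D → G ⊆ ⁅ v ⁆ → H ⊂ F → L ∩ F ≡ ⊥ → Face k j (L ∪ F)
              → Face (suc k) j (G ∪ (H ∪ L))
    Face-cone {j} {G} {H} {L} j<D G⊆v (H⊆F , z , z∈F , z∉H) L∩F≡⊥ f = record
      { avoids    = avoids′
      ; new-above = new-above′
      ; new-below = new-below′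
      ; no-pair   = no-pair′
      ; gap       = z , proj₁ (∈F⁻ z∈F) , proj₂ (∈F⁻ z∈F) , z∉cone
      }
      where
        open Face f
        inL : L ⊆ L ∪ F
        inL = p⊆p∪q F
        j≤k : j ≤ k
        j≤k = Face-⊇F⇒≤ j<D (q⊆p∪q L F) f

        small⇒∈L : x ∈ G ∪ (H ∪ L) → toℕ x ≤ k → x ∈ L
        small⇒∈L p x≤k with ∈cone⁻ G⊆v p
        ... | inj₁ refl        = ⊥-elim (<⇒≱ k<D+k (subst (_≤ k) toℕ-v x≤k))
        ... | inj₂ (inj₁ x∈H) = ⊥-elim (<⇒≱ (proj₁ (∈F⁻ (H⊆F x∈H))) x≤k)
        ... | inj₂ (inj₂ x∈L) = x∈L

        avoids′ : x ∈ G ∪ (H ∪ L) → toℕ x ≢ j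
        avoids′ p e with ∈cone⁻ G⊆v p
        ... | inj₁ refl        = <⇒≢ (≤-<-trans j≤k k<D+k) (trans (sym e) toℕ-v)
        ... | inj₂ (inj₁ x∈H) = <⇒≢ (≤-<-trans j≤k (proj₁ (∈F⁻ (H⊆F x∈H)))) (sym e)
        ... | inj₂ (inj₂ x∈L) = avoids (inL x∈L) e

        new-above′ : x ∈ G ∪ (H ∪ L) → D ≤ toℕ x → D + j ≤ toℕ x
        new-above′ p D≤x with ∈cone⁻ G⊆v p
        ... | inj₁ refl        = subst (D + j ≤_) (sym toℕ-v) (+-monoʳ-≤ D j≤k)
        ... | inj₂ (inj₁ x∈H) = ⊥-elim (<⇒≱ (proj₂ (∈F⁻ (H⊆F x∈H))) D≤x)
        ... | inj₂ (inj₂ x∈L) = new-above (inL x∈L) D≤x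

        new-below′ : x ∈ G ∪ (H ∪ L) → toℕ x < D + suc k
        new-below′ p with ∈cone⁻ G⊆v p
        ... | inj₁ refl        = subst (_< D + suc k) (sym toℕ-v) D+k<D+1+k
        ... | inj₂ (inj₁ x∈H) = <-≤-trans (proj₂ (∈F⁻ (H⊆F x∈H))) (m≤m+n D (suc k))
        ... | inj₂ (inj₂ x∈L) = <-trans (new-below (inL x∈L)) D+k<D+1+k

        no-pair′ : NoPair (G ∪ (H ∪ L))
        no-pair′ {x} p q e with ∈cone⁻ G⊆v q
        ... | inj₁ refl        =
          Face-⊇F⇒o∉ (q⊆p∪q L F) f (inL (subst (_∈ L) (sym o≡x) (small⇒∈L p (≤-reflexive x≡k))))
          where
            x≡k : toℕ x ≡ k
            x≡k = +-cancelˡ-≡ D (toℕ x) k (trans (sym e) toℕ-v)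
            o≡x : o ≡ x
            o≡x = toℕ-injective (trans toℕ-o (sym x≡k))
        ... | inj₂ (inj₁ y∈H) = <⇒≱ (proj₂ (∈F⁻ (H⊆F y∈H))) (paired⇒new e)
        ... | inj₂ (inj₂ y∈L) = no-pair (inL (small⇒∈L p (<⇒≤ x<k))) (inL y∈L) e
          where
            x<k : toℕ x < k
            x<k = +-cancelˡ-< D (toℕ x) k (subst (_< D + k) e (new-below (inL y∈L)))

        z∉cone : z ∉ G ∪ (H ∪ L)
        z∉cone p with ∈cone⁻ G⊆v p
        ... | inj₁ refl        = <⇒≱ (proj₂ (∈F⁻ z∈F)) (paired⇒new toℕ-v)
        ... | inj₂ (inj₁ z∈H) = z∉H z∈H
        ... | inj₂ (inj₂ z∈L) = ∉⊥ (subst (z ∈_) L∩F≡⊥ (x∈p∩q⁺ (z∈L , z∈F)))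

    link : Subset (N d) → Subset (N d)
    link σ = σ ∖ (F ∪ ⁅ v ⁆)

    ∈link∪F⁻ : x ∈ link σ ∪ F → (x ∈ σ × x ≢ v) ⊎ x ∈ F
    ∈link∪F⁻ {σ = σ} p with x∈p∪q⁻ (link σ) F p
    ... | inj₂ x∈F = inj₂ x∈F
    ... | inj₁ q   = let x∈σ , x∉F∪v = ∈∖⁻ q in inj₁ (x∈σ , λ { refl → x∉F∪v (x∈p∪q⁺ (inj₂ (x∈⁅x⁆ v))) })

    Face-link : v ∈ σ → Face (suc k) j σ → Face k j (link σ ∪ F)
    Face-link {σ} {j} v∈σ f = record
      { avoids    = avoids′
      ; new-above = new-above′
      ; new-below = new-below′
      ; no-pair   = no-pair′
      ; gap       = Gap-o o∉
      }
      where
        open Face f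
        j≤k : j ≤ k
        j≤k = Face-∋v⇒≤ v∈σ f

        avoids′ : x ∈ link σ ∪ F → toℕ x ≢ j
        avoids′ p e with ∈link∪F⁻ p
        ... | inj₁ (x∈σ , _) = avoids x∈σ e
        ... | inj₂ x∈F       = <⇒≢ (≤-<-trans j≤k (proj₁ (∈F⁻ x∈F))) (sym e)

        new-above′ : x ∈ link σ ∪ F → D ≤ toℕ x → D + j ≤ toℕ x
        new-above′ p D≤x with ∈link∪F⁻ p
        ... | inj₁ (x∈σ , _) = new-above x∈σ D≤x
        ... | inj₂ x∈F       = ⊥-elim (<⇒≱ (proj₂ (∈F⁻ x∈F)) D≤x)

        new-below′ : x ∈ link σ ∪ F → toℕ x < D + k
        new-below′ p with ∈link∪F⁻ p
        ... | inj₁ (x∈σ , x≢v) = <D+1+k∧≢v⇒<D+k (new-below x∈σ) x≢v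
        ... | inj₂ x∈F         = <-≤-trans (proj₂ (∈F⁻ x∈F)) (m≤m+n D k)

        no-pair′ : NoPair (link σ ∪ F)
        no-pair′ {x} p q e with ∈link∪F⁻ q | ∈link∪F⁻ p
        ... | inj₂ y∈F       | _              = <⇒≱ (proj₂ (∈F⁻ y∈F)) (paired⇒new e)
        ... | inj₁ (y∈σ , _) | inj₁ (x∈σ , _) = no-pair x∈σ y∈σ e
        ... | inj₁ _         | inj₂ x∈F       =
          <-asym (proj₁ (∈F⁻ x∈F)) (+-cancelˡ-< D (toℕ x) k (subst (_< D + k) e (new-below′ q)))

        o∉ : o ∉ link σ ∪ F
        o∉ p with ∈link∪F⁻ p
        ... | inj₁ (o∈σ , _) = no-pair o∈σ v∈σ (trans toℕ-v (cong (D +_) (sym toℕ-o)))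
        ... | inj₂ o∈F       = o∉F o∈F

    module _ {J : List ℕ} (J<D : All (_< D) J) {K : Complex d} (K≐ : K ≐ Faces J k) where

      K-F⇒≤k : K F → Any (_≤ k) J
      K-F⇒≤k KF = Any-mapWithAll J<D (λ j<D → Face-⊇F⇒≤ j<D (λ p → p)) (proj₁ K≐ KF)

      ≤k⇒K-F : Any (_≤ k) J → K F
      ≤k⇒K-F ≤k = proj₂ K≐ (Any.map Face-F ≤k)

      stellar⊆Faces : stellar d F v K σ → Faces J (suc k) σ
      stellar⊆Faces (inj₁ (_ , inj₁ (Kσ , F⊈σ))) = Any.map (Face-suc F⊈σ) (proj₁ K≐ Kσ)
      stellar⊆Faces (inj₁ (_ , inj₂ (_ , _ , _ , G⊆v , H⊂F , L∩F≡⊥ , K-L∪F , refl))) =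
        Any-mapWithAll J<D (λ j<D → Face-cone j<D G⊆v H⊂F L∩F≡⊥) (proj₁ K≐ K-L∪F)
      stellar⊆Faces {σ} (inj₂ (¬KF , Kσ)) = Any.map (Face-suc F⊈σ) (proj₁ K≐ Kσ)
        where
          F⊈σ : ¬ F ⊆ σ
          F⊈σ F⊆σ = ¬KF (proj₂ K≐ (Any.map (Face-mono F⊆σ) (proj₁ K≐ Kσ)))

      Faces⊆stellar : Faces J (suc k) σ → stellar d F v K σ
      Faces⊆stellar {σ} fs with any? (_≤? k) J | v ∈? σ
      ... | no ¬≤k | _       =
        inj₂ (¬≤k ∘ K-F⇒≤k , proj₂ K≐ (Any-mapWithAll (All.¬Any⇒All¬ J ¬≤k) pred fs))
        where
          pred : ∀ {j} → ¬ j ≤ k → Face (suc k) j σ → Face k j σ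
          pred j≰k f = Face-pred (λ v∈σ → j≰k (Face-∋v⇒≤ v∈σ f)) f
      ... | yes ≤k | no v∉σ  =
        inj₁ (≤k⇒K-F ≤k , inj₁ (proj₂ K≐ (Any.map (Face-pred v∉σ) fs) , Gap⇒⊈F (Faces⇒Gap fs)))
      ... | yes ≤k | yes v∈σ =
        inj₁ (≤k⇒K-F ≤k , inj₂ (⁅ v ⁆ , σ ∩ F , link σ , (λ p → p) , Gap⇒∩F⊂F (Faces⇒Gap fs)
                               , ∖∪-disjoint σ F ⁅ v ⁆ , proj₂ K≐ (Any.map (Face-link v∈σ) fs) , split-at F v∈σ))

      stellar≐Faces : stellar d F v K ≐ Faces J (suc k)
      stellar≐Faces = stellar⊆Faces , Faces⊆stellar

  subdivide : Complex d → Fin (d + 1) → Complex d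
  subdivide K i = stellar d (Fface d i) (newV d i) K

  module _ {J : List ℕ} (J<D : All (_< D) J) where

    subdivide-tabulate≐Faces : ∀ {n} {K : Complex d} (f : Fin n → Fin (d + 1)) k → (∀ t → toℕ (f t) ≡ k + toℕ t)
                             → K ≐ Faces J k → foldl subdivide K (tabulate f) ≐ Faces J (k + n)
    subdivide-tabulate≐Faces {zero}  {K} f k _  K≐ = subst (λ k′ → K ≐ Faces J k′) (sym (+-identityʳ k)) K≐
    subdivide-tabulate≐Faces {suc n} {K} f k f≡ K≐ = subst (λ k′ → K′ ≐ Faces J k′) (sym (+-suc k n))
      (subdivide-tabulate≐Faces (f ∘ suc) (suc k) (λ t → trans (f≡ (suc t)) (+-suc k (toℕ t)))
        (subst (λ k′ → subdivide K (f zero) ≐ Faces J (suc k′)) f₀≡k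
          (Stage.stellar≐Faces (f zero) J<D (subst (λ k′ → K ≐ Faces J k′) (sym f₀≡k) K≐))))
      where
        K′ : Complex d
        K′ = foldl subdivide (subdivide K (f zero)) (tabulate (f ∘ suc))
        f₀≡k : toℕ (f zero) ≡ k
        f₀≡k = trans (f≡ zero) (+-identityʳ k)

    diamond≐Faces : diamond d J ≐ Faces J (d + 1)
    diamond≐Faces = subdivide-tabulate≐Faces (λ t → t) 0 (λ _ → refl) (generated≐Faces₀ J<D)

  module _ {ℓ : ℕ} {τ : Subset (N d)} where

    private
      Covered : V → Set
      Covered x = x ∈ τ ⊎ toℕ x ≤ ℓ

      covered? : ∀ x → Dec (Covered x)
      covered? x = x ∈? τ ⊎-dec toℕ x ≤? ℓ

    -- j is the least index above ℓ whose original vertex τ misses: a new vertex v_m ∈ τ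
    -- has ℓ < m and m ∉ τ, hence j ≤ m.
    least-missing⇒Face : ℓ < d + 1 → (∀ {y} → y ∈ τ → D ≤ toℕ y → D + ℓ < toℕ y) → NoPair τ
                       → Gap (d + 1) τ → ∃ λ j → ℓ < j × j < D × Face (d + 1) j τ
    least-missing⇒Face ℓ<d+1 above no-pair (z , d+1≤z , z<D , z∉τ)
      with ¬∀⟶∃¬-smallest (N d) Covered covered? (λ all → z-uncovered (all z))
      where
        z-uncovered : ¬ Covered z
        z-uncovered = [ z∉τ , <⇒≱ ℓ<d+1 ∘ ≤-trans d+1≤z ]′
    ... | x , x-uncovered , smaller = toℕ x , ≰⇒> (x-uncovered ∘ inj₂) , ≤-<-trans x≤z z<D , record
        { avoids    = λ p e → x-uncovered (inj₁ (subst (_∈ τ) (toℕ-injective e) p))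
        ; new-above = new-above
        ; new-below = λ {y} _ → toℕ<n y
        ; no-pair   = no-pair
        ; gap       = z , d+1≤z , z<D , z∉τ
        }
      where
        below⇒covered : toℕ y < toℕ x → Covered y
        below⇒covered {y} y<x =
          subst Covered (toℕ-injective (trans (toℕ-inject _) (toℕ-fromℕ< y<x))) (smaller (fromℕ< y<x))

        x≤z : toℕ x ≤ toℕ z
        x≤z = ≮⇒≥ λ z<x → [ z∉τ , <⇒≱ ℓ<d+1 ∘ ≤-trans d+1≤z ]′ (below⇒covered z<x)

        new-above : y ∈ τ → D ≤ toℕ y → D + toℕ x ≤ toℕ y
        new-above {y} y∈τ D≤y = subst (D + toℕ x ≤_) D+i≡y (+-monoʳ-≤ D (≮⇒≥ i≮x))
          where
            i : ℕ
            i = toℕ y ∸ D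
            D+i≡y : D + i ≡ toℕ y
            D+i≡y = m+[n∸m]≡n D≤y
            i<D : i < D
            i<D = <-trans (+-cancelˡ-< D i (d + 1) (subst (_< N d) (sym D+i≡y) (toℕ<n y))) d+1<D
            ℓ<i : ℓ < i
            ℓ<i = +-cancelˡ-< D ℓ i (subst (D + ℓ <_) (sym D+i≡y) (above y∈τ D≤y))
            oi∉τ : orig i i<D ∉ τ
            oi∉τ oi∈τ = no-pair oi∈τ y∈τ (trans (sym D+i≡y) (cong (D +_) (sym (toℕ-orig i<D))))
            i≮x : ¬ i < toℕ x
            i≮x i<x = [ oi∉τ , <⇒≱ ℓ<i ∘ subst (_≤ ℓ) (toℕ-orig i<D) ]′
                        (below⇒covered (subst (_< toℕ x) (sym (toℕ-orig i<D)) i<x))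

  module Swap (ℓ : ℕ) (ℓ≤d : ℓ ≤ d) where

    ℓ<d+1 : ℓ < d + 1
    ℓ<d+1 = subst (ℓ <_) (+-comm 1 d) (s≤s ℓ≤d)

    ℓ<D : ℓ < D
    ℓ<D = <-trans ℓ<d+1 d+1<D

    oℓ vℓ : V
    oℓ = orig ℓ ℓ<D
    vℓ = newV d (fromℕ< ℓ<d+1)

    toℕ-oℓ : toℕ oℓ ≡ ℓ
    toℕ-oℓ = toℕ-orig ℓ<D

    toℕ-vℓ : toℕ vℓ ≡ D + ℓ
    toℕ-vℓ = trans (toℕ-↑ʳ D _) (cong (D +_) (toℕ-fromℕ< ℓ<d+1))

    oℓ-old : ¬ D ≤ toℕ oℓ
    oℓ-old = <⇒≱ (subst (_< D) (sym toℕ-oℓ) ℓ<D)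

    no-index-D+vℓ : toℕ y ≢ D + toℕ vℓ
    no-index-D+vℓ {y} e = <⇒≱ (toℕ<n y) (subst (D + (d + 1) ≤_) (sym e) (+-monoʳ-≤ D d+1≤vℓ))
      where
        d+1≤vℓ : d + 1 ≤ toℕ vℓ
        d+1≤vℓ = <⇒≤ (<-≤-trans d+1<D (paired⇒new toℕ-vℓ))

    -- Stated for any s transposing oℓ and vℓ, since both π ⟨$⟩ʳ_ and π ⟨$⟩ˡ_ are needed.
    IsSwap : (V → V) → Set
    IsSwap s = ∀ x → TransposeView s oℓ vℓ x

    MapsInto : (V → V) → Subset (N d) → Subset (N d) → Set
    MapsInto s τ σ = ∀ {y} → y ∈ τ → s y ∈ σ

    module _ {s : V → V} (s-swap : IsSwap s) where

      NoPair-swap : MapsInto s τ σ → NoPair σ → NoPair τ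
      NoPair-swap {τ} {σ} τ→σ no-pair {x} {y} x∈τ y∈τ e with s-swap y | s-swap x
      ... | at-a refl _    | _              = oℓ-old (paired⇒new e)
      ... | at-b refl sy≡o | at-a refl sx≡v =
        no-pair (subst (_∈ σ) sy≡o (τ→σ y∈τ)) (subst (_∈ σ) sx≡v (τ→σ x∈τ))
                (trans toℕ-vℓ (cong (D +_) (sym toℕ-oℓ)))
      ... | at-b refl _    | at-b refl _    = <⇒≢ (m<n+m (toℕ vℓ) (≤1+d⇒<D z≤n)) e
      ... | at-b refl _    | other x≢o _ _  =
        x≢o (toℕ-injective (trans (+-cancelˡ-≡ D _ _ (trans (sym e) toℕ-vℓ)) (sym toℕ-oℓ)))
      ... | other _ y≢v _  | at-a refl _    =
        y≢v (toℕ-injective (trans e (trans (cong (D +_) toℕ-oℓ) (sym toℕ-vℓ))))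
      ... | other _ _ _    | at-b refl _    = no-index-D+vℓ e
      ... | other _ _ sy≡y | other _ _ sx≡x =
        no-pair (subst (_∈ σ) sx≡x (τ→σ x∈τ)) (subst (_∈ σ) sy≡y (τ→σ y∈τ)) e

      Gap-swap : MapsInto s τ σ → Gap (d + 1) σ → Gap (d + 1) τ
      Gap-swap {τ} {σ} τ→σ (z , d+1≤z , z<D , z∉σ) = z , d+1≤z , z<D , z∉τ
        where
          z∉τ : z ∉ τ
          z∉τ z∈τ with s-swap z
          ... | at-a refl _    = <⇒≱ ℓ<d+1 (subst (d + 1 ≤_) toℕ-oℓ d+1≤z)
          ... | at-b refl _    = <⇒≱ z<D (paired⇒new toℕ-vℓ)
          ... | other _ _ sz≡z = z∉σ (subst (_∈ σ) sz≡z (τ→σ z∈τ))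

      Face-swap-below : j < ℓ → MapsInto s τ σ → Face (d + 1) j σ → Face (d + 1) j τ
      Face-swap-below {j} {τ} {σ} j<ℓ τ→σ f = record
        { avoids    = avoids′
        ; new-above = new-above′
        ; new-below = λ {y} _ → toℕ<n y
        ; no-pair   = NoPair-swap τ→σ no-pair
        ; gap       = Gap-swap τ→σ gap
        }
        where
          open Face f
          avoids′ : y ∈ τ → toℕ y ≢ j
          avoids′ {y} y∈τ e with s-swap y
          ... | at-a refl _    = <⇒≢ j<ℓ (trans (sym e) toℕ-oℓ)
          ... | at-b refl _    = <⇒≢ (<-≤-trans j<ℓ (m≤n+m ℓ D)) (trans (sym e) toℕ-vℓ)
          ... | other _ _ sy≡y = avoids (subst (_∈ σ) sy≡y (τ→σ y∈τ)) e
          new-above′ : y ∈ τ → D ≤ toℕ y → D + j ≤ toℕ y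
          new-above′ {y} y∈τ D≤y with s-swap y
          ... | at-a refl _    = ⊥-elim (oℓ-old D≤y)
          ... | at-b refl _    = subst (D + j ≤_) (sym toℕ-vℓ) (+-monoʳ-≤ D (<⇒≤ j<ℓ))
          ... | other _ _ sy≡y = new-above (subst (_∈ σ) sy≡y (τ→σ y∈τ)) D≤y

      Face-swap-above : ℓ < j → MapsInto s σ τ → Face (d + 1) j τ → Face (d + 1) ℓ σ
      Face-swap-above {j} {σ} {τ} ℓ<j σ→τ f = record
        { avoids    = avoids′
        ; new-above = new-above′
        ; new-below = λ {x} _ → toℕ<n x
        ; no-pair   = NoPair-swap σ→τ no-pair
        ; gap       = Gap-swap σ→τ gap
        }
        where
          open Face f
          avoids′ : x ∈ σ → toℕ x ≢ ℓ
          avoids′ {x} x∈σ e with s-swap x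
          ... | at-a refl sx≡v =
            <⇒≱ (+-monoʳ-< D ℓ<j) (subst (D + j ≤_) toℕ-vℓ (new-above (subst (_∈ τ) sx≡v (σ→τ x∈σ)) (paired⇒new toℕ-vℓ)))
          ... | at-b refl _    = <⇒≱ (subst (_< D) (sym e) ℓ<D) (paired⇒new toℕ-vℓ)
          ... | other x≢o _ _  = x≢o (toℕ-injective (trans e (sym toℕ-oℓ)))
          new-above′ : x ∈ σ → D ≤ toℕ x → D + ℓ ≤ toℕ x
          new-above′ {x} x∈σ D≤x with s-swap x
          ... | at-a refl _    = ⊥-elim (oℓ-old D≤x)
          ... | at-b refl _    = ≤-reflexive (sym toℕ-vℓ)
          ... | other _ _ sx≡x = ≤-trans (+-monoʳ-≤ D (<⇒≤ ℓ<j)) (new-above (subst (_∈ τ) sx≡x (σ→τ x∈σ)) D≤x)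

      Face-swap-at : MapsInto s τ σ → Face (d + 1) ℓ σ → ∃ λ j → ℓ < j × j < D × Face (d + 1) j τ
      Face-swap-at {τ} {σ} τ→σ f = least-missing⇒Face ℓ<d+1 above (NoPair-swap τ→σ no-pair) (Gap-swap τ→σ gap)
        where
          open Face f
          above : y ∈ τ → D ≤ toℕ y → D + ℓ < toℕ y
          above {y} y∈τ D≤y with s-swap y
          ... | at-a refl _      = ⊥-elim (oℓ-old D≤y)
          ... | at-b refl sy≡o   = ⊥-elim (avoids (subst (_∈ σ) sy≡o (τ→σ y∈τ)) toℕ-oℓ)
          ... | other _ y≢v sy≡y = ≤∧≢⇒< (new-above (subst (_∈ σ) sy≡y (τ→σ y∈τ)) D≤y)
                                         (λ e → y≢v (toℕ-injective (trans (sym e) (sym toℕ-vℓ))))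

    π : Permutation′ (N d)
    π = transpose oℓ vℓ

    π⁻¹-swap : IsSwap (π ⟨$⟩ˡ_)
    π⁻¹-swap x = TransposeView-sym (transpose-view vℓ oℓ x)

    π-swap : IsSwap (π ⟨$⟩ʳ_)
    π-swap = transpose-view oℓ vℓ

    image⇒π⁻¹ : MapsInto (π ⟨$⟩ˡ_) (image π σ) σ
    image⇒π⁻¹ = ∈-image⁻ π

    π⇒image : MapsInto (π ⟨$⟩ʳ_) σ (image π σ)
    π⇒image {σ} y∈σ = ∈-image⁺ π (subst (_∈ σ) (sym (inverseˡ π)) y∈σ)

    Upper : List ℕ
    Upper = map (λ t → suc ℓ + t) (upTo (suc d ∸ ℓ))

    ℓ+[1+d∸ℓ]≡1+d : ℓ + (suc d ∸ ℓ) ≡ suc d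
    ℓ+[1+d∸ℓ]≡1+d = m+[n∸m]≡n (≤-trans ℓ≤d (n≤1+n d))

    module _ {is : List ℕ} (is<ℓ : All (_< ℓ) is) where

      lower<D : All (_< D) (is ++ ℓ ∷ [])
      lower<D = All.++⁺ (All.map (λ j<ℓ → <-trans j<ℓ ℓ<D) is<ℓ) (ℓ<D ∷ [])

      upper<D : All (_< D) (is ++ Upper)
      upper<D = All.++⁺ (All.map (λ j<ℓ → <-trans j<ℓ ℓ<D) is<ℓ)
                        (All-upFrom⁺ λ {j} _ j≤ → ≤1+d⇒<D (subst (j ≤_) ℓ+[1+d∸ℓ]≡1+d j≤))

      swap-Faces : Faces (is ++ ℓ ∷ []) (d + 1) σ → Faces (is ++ Upper) (d + 1) (image π σ)
      swap-Faces fs with Any.++⁻ is fs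
      ... | inj₁ below = Any.++⁺ˡ (Any-mapWithAll is<ℓ (λ j<ℓ → Face-swap-below π⁻¹-swap j<ℓ image⇒π⁻¹) below)
      ... | inj₂ (here f) with Face-swap-at π⁻¹-swap image⇒π⁻¹ f
      ...   | j , ℓ<j , j<D , fj =
        Any.++⁺ʳ is (Any-upFrom⁺ ℓ<j (subst (j ≤_) (sym ℓ+[1+d∸ℓ]≡1+d) (<D⇒≤1+d j<D)) fj)

      unswap-Faces : Faces (is ++ Upper) (d + 1) (image π σ) → Faces (is ++ ℓ ∷ []) (d + 1) σ
      unswap-Faces fs with Any.++⁻ is fs
      ... | inj₁ below = Any.++⁺ˡ (Any-mapWithAll is<ℓ (λ j<ℓ → Face-swap-below π-swap j<ℓ π⇒image) below)
      ... | inj₂ above with Any-upFrom⁻ above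
      ...   | j , ℓ<j , _ , fj = Any.++⁺ʳ is (here (Face-swap-above π-swap ℓ<j π⇒image fj))

lemma4p2 : (d ℓ : ℕ) → (is : List ℕ) → ℓ ≤ d → Linked _<_ is → All (_< ℓ) is →
    Iso d (diamond d (is ++ (ℓ ∷ []))) (diamond d (is ++ map (λ t → suc ℓ + t) (upTo (suc d ∸ ℓ))))
lemma4p2 d ℓ is ℓ≤d _ is<ℓ = π , λ σ →
    (λ ◇σ → proj₂ ◇upper≐ (swap-Faces is<ℓ (proj₁ ◇lower≐ ◇σ)))
  , (λ ◇πσ → proj₂ ◇lower≐ (unswap-Faces is<ℓ (proj₁ ◇upper≐ ◇πσ)))
  where
    open Stages d
    open Swap ℓ ℓ≤d
    ◇lower≐ : diamond d (is ++ ℓ ∷ []) ≐ Faces (is ++ ℓ ∷ []) (d + 1)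
    ◇lower≐ = diamond≐Faces (lower<D is<ℓ)
    ◇upper≐ : diamond d (is ++ Upper) ≐ Faces (is ++ Upper) (d + 1)
    ◇upper≐ = diamond≐Faces (upper<D is<ℓ)
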